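{- Let $s,a,\sigma$ be positive integers, let $X$ be a set of cardinality $s$, and let $\pi_1,\ldots,\pi_\sigma$ be partitions of $X$ such that every part of $\pi_i$ has cardinality at least $a$, for every $i\in\{1,\ldots,\sigma\}$. Then there exists a subset $Y\subseteq X$ with $|Y|\ge s(1-1/a)^\sigma$ such that $Y$ contains no part of $\pi_i$ for any $i\in\{1,\ldots,\sigma\}$. -}

module Defs where

open import Data.Nat using (ℕ; _≤_; _≟_)
open import Data.Fin using (Fin)
open import Data.Fin.Subset using (Subset; _∈_; _∉_; _⊆_; ∣_∣)
open import Data.Vec using (tabulate)
open import Relation.Nullary.Decidable using (does)
open import Relation.Nullary using (¬_)

-- X is modelled as Fin s (a set of cardinality s).
-- A partition of Fin s is represented by a labelling p : Fin s → ℕ;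
-- its parts are the fibres  { y | p y ≡ p x }  (x ∈ Fin s), which are
-- nonempty and pairwise disjoint and cover Fin s.  Every partition of
-- Fin s arises this way.

part : ∀ {s} → (Fin s → ℕ) → Fin s → Subset s
part p x = tabulate (λ y → does (p y ≟ p x))

AllPartsAtLeast : ∀ {s} → ℕ → (Fin s → ℕ) → Set
AllPartsAtLeast a p = ∀ x → a ≤ ∣ part p x ∣

ContainsNoPart : ∀ {s} → Subset s → (Fin s → ℕ) → Set
ContainsNoPart Y p = ∀ x → ¬ (part p x ⊆ Y)

-- Handle one partition greedily: run through the points x and delete x
-- whenever its whole part still lies in Y.  Call y full if its part lies in Y.
-- A deletion removes one element of Y but at least a full elements (the part
-- of x, which is disjoint from the full elements left afterwards), and there
-- are at most |Y| full elements to start with; so there are at most |Y|/a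
-- deletions and |Y′| ≥ (1 − 1/a)|Y|.  Repeat for every partition: deleting
-- points never makes a part contained.

module Submission where

open import Defs
open import Data.Bool using (true; false)
open import Data.Fin using (Fin; zero; suc; _≟_)
open import Data.Fin.Subset
open import Data.Fin.Subset.Properties
open import Data.List using (List; []; _∷_; foldl; allFin)
open import Data.List.Membership.Propositional using () renaming (_∈_ to _∈ₗ_)
open import Data.List.Membership.Propositional.Properties using (∈-allFin)
import Data.List.Relation.Unary.Any as Any
open import Data.Nat using (ℕ; NonZero; _≤_; _+_; _*_; _^_; _∸_; suc) renaming (_≟_ to _≟ℕ_)
open import Data.Nat.Properties hiding (_≟_)
open import Algebra.Properties.CommutativeSemigroup *-commutativeSemigroup using (x∙yz≈y∙xz; xy∙z≈y∙xz)
open import Data.Product using (∃; _×_; _,_)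
open import Data.Sum using (inj₁; inj₂)
open import Data.Vec using ([]; _∷_; here; there; tabulate)
open import Data.Vec.Properties using (lookup∘tabulate; lookup⇒[]=; []=⇒lookup)
open import Relation.Nullary using (¬_; yes; no; does)
open import Relation.Nullary.Decidable using (dec-true)
open import Relation.Unary using (Pred; Decidable)
open import Relation.Binary.PropositionalEquality

∣p∪q∣+∣p∩q∣≡∣p∣+∣q∣ : ∀ {n} (p q : Subset n) → ∣ p ∪ q ∣ + ∣ p ∩ q ∣ ≡ ∣ p ∣ + ∣ q ∣
∣p∪q∣+∣p∩q∣≡∣p∣+∣q∣ []          []          = refl
∣p∪q∣+∣p∩q∣≡∣p∣+∣q∣ (true  ∷ p) (true  ∷ q) = cong suc (begin
  ∣ p ∪ q ∣ + suc ∣ p ∩ q ∣   ≡⟨ +-suc _ _ ⟩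
  suc (∣ p ∪ q ∣ + ∣ p ∩ q ∣) ≡⟨ cong suc (∣p∪q∣+∣p∩q∣≡∣p∣+∣q∣ p q) ⟩
  suc (∣ p ∣ + ∣ q ∣)         ≡⟨ +-suc _ _ ⟨
  ∣ p ∣ + suc ∣ q ∣ ∎)
  where open ≡-Reasoning
∣p∪q∣+∣p∩q∣≡∣p∣+∣q∣ (true  ∷ p) (false ∷ q) = cong suc (∣p∪q∣+∣p∩q∣≡∣p∣+∣q∣ p q)
∣p∪q∣+∣p∩q∣≡∣p∣+∣q∣ (false ∷ p) (true  ∷ q) = trans (cong suc (∣p∪q∣+∣p∩q∣≡∣p∣+∣q∣ p q)) (sym (+-suc _ _))
∣p∪q∣+∣p∩q∣≡∣p∣+∣q∣ (false ∷ p) (false ∷ q) = ∣p∪q∣+∣p∩q∣≡∣p∣+∣q∣ p q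

∣p∪q∣≤∣p∣+∣q∣ : ∀ {n} (p q : Subset n) → ∣ p ∪ q ∣ ≤ ∣ p ∣ + ∣ q ∣
∣p∪q∣≤∣p∣+∣q∣ p q = subst (∣ p ∪ q ∣ ≤_) (∣p∪q∣+∣p∩q∣≡∣p∣+∣q∣ p q) (m≤m+n _ _)

Empty[p∩q]⇒∣p∣+∣q∣≡∣p∪q∣ : ∀ {n} (p q : Subset n) → Empty (p ∩ q) → ∣ p ∣ + ∣ q ∣ ≡ ∣ p ∪ q ∣
Empty[p∩q]⇒∣p∣+∣q∣≡∣p∪q∣ {n} p q disjoint = begin
  ∣ p ∣ + ∣ q ∣             ≡⟨ ∣p∪q∣+∣p∩q∣≡∣p∣+∣q∣ p q ⟨
  ∣ p ∪ q ∣ + ∣ p ∩ q ∣     ≡⟨ cong (λ r → ∣ p ∪ q ∣ + ∣ r ∣) (Empty-unique disjoint) ⟩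
  ∣ p ∪ q ∣ + ∣ ⊥ {n} ∣     ≡⟨ cong (∣ p ∪ q ∣ +_) (∣⊥∣≡0 n) ⟩
  ∣ p ∪ q ∣ + 0             ≡⟨ +-identityʳ _ ⟩
  ∣ p ∪ q ∣ ∎
  where open ≡-Reasoning

x∈q⇒x∉p─q : ∀ {n} {x : Fin n} (p q : Subset n) → x ∈ q → x ∉ p ─ q
x∈q⇒x∉p─q (_ ∷ p) (true ∷ q) here ()
x∈q⇒x∉p─q (_ ∷ p) (_ ∷ q) (there x∈q) (there x∈p─q) = x∈q⇒x∉p─q p q x∈q x∈p─q

x∉p-x : ∀ {n} (p : Subset n) x → x ∉ p - x
x∉p-x p x = x∈q⇒x∉p─q p ⁅ x ⁆ (x∈⁅x⁆ x)

∣p∣≤∣p-x∣+1 : ∀ {n} (p : Subset n) x → ∣ p ∣ ≤ ∣ p - x ∣ + 1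
∣p∣≤∣p-x∣+1 p x = begin
  ∣ p ∣                   ≤⟨ p⊆q⇒∣p∣≤∣q∣ p⊆[p-x]∪⁅x⁆ ⟩
  ∣ (p - x) ∪ ⁅ x ⁆ ∣     ≤⟨ ∣p∪q∣≤∣p∣+∣q∣ (p - x) ⁅ x ⁆ ⟩
  ∣ p - x ∣ + ∣ ⁅ x ⁆ ∣   ≡⟨ cong (∣ p - x ∣ +_) (∣⁅x⁆∣≡1 x) ⟩
  ∣ p - x ∣ + 1 ∎
  where
  open ≤-Reasoning
  p⊆[p-x]∪⁅x⁆ : p ⊆ (p - x) ∪ ⁅ x ⁆
  p⊆[p-x]∪⁅x⁆ {y} y∈p with y ≟ x
  ... | yes refl = x∈p∪q⁺ (inj₂ (x∈⁅x⁆ x))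
  ... | no y≢x   = x∈p∪q⁺ (inj₁ (x∈p∧x≢y⇒x∈p-y y∈p y≢x))

select : ∀ {n ℓ} {P : Pred (Fin n) ℓ} → Decidable P → Subset n
select P? = tabulate (λ x → does (P? x))

module _ {n ℓ} {P : Pred (Fin n) ℓ} (P? : Decidable P) where

  ∈-select⁺ : ∀ {x} → P x → x ∈ select P?
  ∈-select⁺ {x} px = lookup⇒[]= x _ (trans (lookup∘tabulate _ x) (dec-true (P? x) px))

  ∈-select⁻ : ∀ {x} → x ∈ select P? → P x
  ∈-select⁻ {x} x∈ with P? x | trans (sym (lookup∘tabulate _ x)) ([]=⇒lookup x∈)
  ... | yes px | _  = px
  ... | no  _  | ()

module _ {s} (p : Fin s → ℕ) where

  ∈-part⁺ : ∀ {x y} → p y ≡ p x → y ∈ part p x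
  ∈-part⁺ {x} = ∈-select⁺ (λ y → p y ≟ℕ p x)

  ∈-part⁻ : ∀ {x y} → y ∈ part p x → p y ≡ p x
  ∈-part⁻ {x} = ∈-select⁻ (λ y → p y ≟ℕ p x)

  x∈part[x] : ∀ x → x ∈ part p x
  x∈part[x] x = ∈-part⁺ refl

  part-⊆ : ∀ {x y} → y ∈ part p x → part p y ⊆ part p x
  part-⊆ y∈ z∈ = ∈-part⁺ (trans (∈-part⁻ z∈) (∈-part⁻ y∈))

  x∈part[y]⇒y∈part[x] : ∀ {x y} → x ∈ part p y → y ∈ part p x
  x∈part[y]⇒y∈part[x] x∈ = ∈-part⁺ (sym (∈-part⁻ x∈))

  full : Subset s → Subset s
  full Y = select (λ x → part p x ⊆? Y)

  ∈-full⁺ : ∀ {Y x} → part p x ⊆ Y → x ∈ full Y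
  ∈-full⁺ {Y} = ∈-select⁺ (λ x → part p x ⊆? Y)

  ∈-full⁻ : ∀ {Y x} → x ∈ full Y → part p x ⊆ Y
  ∈-full⁻ {Y} = ∈-select⁻ (λ x → part p x ⊆? Y)

  full⊆ : ∀ Y → full Y ⊆ Y
  full⊆ Y x∈ = ∈-full⁻ x∈ (x∈part[x] _)

  full-mono : ∀ {Y Z} → Y ⊆ Z → full Y ⊆ full Z
  full-mono Y⊆Z x∈ = ∈-full⁺ (⊆-trans (∈-full⁻ x∈) Y⊆Z)

  part⊆full : ∀ {Y x} → part p x ⊆ Y → part p x ⊆ full Y
  part⊆full part⊆Y y∈ = ∈-full⁺ (⊆-trans (part-⊆ y∈) part⊆Y)

  ∣full[Y-x]∣+∣part∣≤∣full[Y]∣ : ∀ {Y x} → part p x ⊆ Y → ∣ full (Y - x) ∣ + ∣ part p x ∣ ≤ ∣ full Y ∣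
  ∣full[Y-x]∣+∣part∣≤∣full[Y]∣ {Y} {x} part⊆Y = begin
    ∣ full (Y - x) ∣ + ∣ part p x ∣   ≡⟨ Empty[p∩q]⇒∣p∣+∣q∣≡∣p∪q∣ _ _ disjoint ⟩
    ∣ full (Y - x) ∪ part p x ∣       ≤⟨ p⊆q⇒∣p∣≤∣q∣ union⊆ ⟩
    ∣ full Y ∣ ∎
    where
    open ≤-Reasoning
    disjoint : Empty (full (Y - x) ∩ part p x)
    disjoint (y , y∈) with x∈p∩q⁻ _ _ y∈
    ... | y∈full , y∈part = x∉p-x Y x (∈-full⁻ y∈full (x∈part[y]⇒y∈part[x] y∈part))
    union⊆ : full (Y - x) ∪ part p x ⊆ full Y
    union⊆ y∈ with x∈p∪q⁻ _ _ y∈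
    ... | inj₁ y∈full = full-mono (p─q⊆p Y ⁅ x ⁆) y∈full
    ... | inj₂ y∈part = part⊆full part⊆Y y∈part

  prune-at : Subset s → Fin s → Subset s
  prune-at Y x with part p x ⊆? Y
  ... | yes _ = Y - x
  ... | no  _ = Y

  prune : Subset s → List (Fin s) → Subset s
  prune = foldl prune-at

  prune-at-⊆ : ∀ Y x → prune-at Y x ⊆ Y
  prune-at-⊆ Y x with part p x ⊆? Y
  ... | yes _ = p─q⊆p Y ⁅ x ⁆
  ... | no  _ = ⊆-refl

  prune-⊆ : ∀ Y L → prune Y L ⊆ Y
  prune-⊆ Y []      = ⊆-refl
  prune-⊆ Y (x ∷ L) = ⊆-trans (prune-⊆ (prune-at Y x) L) (prune-at-⊆ Y x)

  part⊈prune-at : ∀ Y x → ¬ part p x ⊆ prune-at Y x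
  part⊈prune-at Y x with part p x ⊆? Y
  ... | yes _      = λ part⊆Y-x → x∉p-x Y x (part⊆Y-x (x∈part[x] x))
  ... | no  part⊈Y = part⊈Y

  part⊈prune : ∀ Y {x} L → x ∈ₗ L → ¬ part p x ⊆ prune Y L
  part⊈prune Y (x ∷ L) (Any.here refl) part⊆ = part⊈prune-at Y x (⊆-trans part⊆ (prune-⊆ (prune-at Y x) L))
  part⊈prune Y (_ ∷ L) (Any.there x∈L)      = part⊈prune (prune-at Y _) L x∈L

  record Pruning (a : ℕ) (Y Y′ : Subset s) : Set where
    field
      removed    : ℕ
      size-bound : ∣ Y ∣ ≤ ∣ Y′ ∣ + removed
      full-drop  : a * removed + ∣ full Y′ ∣ ≤ ∣ full Y ∣

  Pruning-refl : ∀ {a} Y → Pruning a Y Y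
  Pruning-refl {a} Y = record
    { removed    = 0
    ; size-bound = m≤m+n ∣ Y ∣ 0
    ; full-drop  = ≤-reflexive (cong (_+ ∣ full Y ∣) (*-zeroʳ a))
    }

  Pruning-trans : ∀ {a X Y Z} → Pruning a X Y → Pruning a Y Z → Pruning a X Z
  Pruning-trans {a} {X} {Y} {Z} X⇝Y Y⇝Z = record
    { removed    = k + l
    ; size-bound = begin
        ∣ X ∣           ≤⟨ size-bound X⇝Y ⟩
        ∣ Y ∣ + k       ≤⟨ +-monoˡ-≤ k (size-bound Y⇝Z) ⟩
        ∣ Z ∣ + l + k   ≡⟨ +-assoc ∣ Z ∣ l k ⟩
        ∣ Z ∣ + (l + k) ≡⟨ cong (∣ Z ∣ +_) (+-comm l k) ⟩
        ∣ Z ∣ + (k + l) ∎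
    ; full-drop  = begin
        a * (k + l) + ∣ full Z ∣     ≡⟨ cong (_+ ∣ full Z ∣) (*-distribˡ-+ a k l) ⟩
        a * k + a * l + ∣ full Z ∣   ≡⟨ +-assoc (a * k) (a * l) _ ⟩
        a * k + (a * l + ∣ full Z ∣) ≤⟨ +-monoʳ-≤ (a * k) (full-drop Y⇝Z) ⟩
        a * k + ∣ full Y ∣           ≤⟨ full-drop X⇝Y ⟩
        ∣ full X ∣ ∎
    }
    where
    open Pruning
    open ≤-Reasoning
    k = removed X⇝Y
    l = removed Y⇝Z

  Pruning⇒[a∸1]*∣Y∣≤a*∣Y′∣ : ∀ {a Y Y′} → Pruning a Y Y′ → (a ∸ 1) * ∣ Y ∣ ≤ a * ∣ Y′ ∣
  Pruning⇒[a∸1]*∣Y∣≤a*∣Y′∣ {a} {Y} {Y′} Y⇝Y′ = begin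
    (a ∸ 1) * ∣ Y ∣       ≡⟨ *-distribʳ-∸ ∣ Y ∣ a 1 ⟩
    a * ∣ Y ∣ ∸ 1 * ∣ Y ∣ ≡⟨ cong (a * ∣ Y ∣ ∸_) (*-identityˡ ∣ Y ∣) ⟩
    a * ∣ Y ∣ ∸ ∣ Y ∣     ≤⟨ m≤n+o⇒m∸n≤o (a * ∣ Y ∣) ∣ Y ∣ a∣Y∣≤∣Y∣+a∣Y′∣ ⟩
    a * ∣ Y′ ∣ ∎
    where
    open Pruning Y⇝Y′
    open ≤-Reasoning
    a∣Y∣≤∣Y∣+a∣Y′∣ : a * ∣ Y ∣ ≤ ∣ Y ∣ + a * ∣ Y′ ∣
    a∣Y∣≤∣Y∣+a∣Y′∣ = begin
      a * ∣ Y ∣                    ≤⟨ *-monoʳ-≤ a size-bound ⟩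
      a * (∣ Y′ ∣ + removed)       ≡⟨ *-distribˡ-+ a ∣ Y′ ∣ removed ⟩
      a * ∣ Y′ ∣ + a * removed     ≤⟨ +-monoʳ-≤ (a * ∣ Y′ ∣) (m+n≤o⇒m≤o (a * removed) full-drop) ⟩
      a * ∣ Y′ ∣ + ∣ full Y ∣      ≤⟨ +-monoʳ-≤ (a * ∣ Y′ ∣) (p⊆q⇒∣p∣≤∣q∣ (full⊆ Y)) ⟩
      a * ∣ Y′ ∣ + ∣ Y ∣           ≡⟨ +-comm (a * ∣ Y′ ∣) ∣ Y ∣ ⟩
      ∣ Y ∣ + a * ∣ Y′ ∣ ∎

  prune-at-Pruning : ∀ {a} → AllPartsAtLeast a p → ∀ Y x → Pruning a Y (prune-at Y x)
  prune-at-Pruning {a} parts≥a Y x with part p x ⊆? Y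
  ... | no  _      = Pruning-refl Y
  ... | yes part⊆Y = record
    { removed    = 1
    ; size-bound = ∣p∣≤∣p-x∣+1 Y x
    ; full-drop  = begin
        a * 1 + ∣ full (Y - x) ∣           ≡⟨ cong (_+ ∣ full (Y - x) ∣) (*-identityʳ a) ⟩
        a + ∣ full (Y - x) ∣               ≤⟨ +-monoˡ-≤ _ (parts≥a x) ⟩
        ∣ part p x ∣ + ∣ full (Y - x) ∣    ≡⟨ +-comm ∣ part p x ∣ _ ⟩
        ∣ full (Y - x) ∣ + ∣ part p x ∣    ≤⟨ ∣full[Y-x]∣+∣part∣≤∣full[Y]∣ part⊆Y ⟩
        ∣ full Y ∣ ∎
    }
    where open ≤-Reasoning

  prune-Pruning : ∀ {a} → AllPartsAtLeast a p → ∀ Y L → Pruning a Y (prune Y L)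
  prune-Pruning parts≥a Y []      = Pruning-refl Y
  prune-Pruning parts≥a Y (x ∷ L) =
    Pruning-trans (prune-at-Pruning parts≥a Y x) (prune-Pruning parts≥a (prune-at Y x) L)

  avoid-partition : ∀ {a} → AllPartsAtLeast a p → ∀ Y →
    ∃ λ Y′ → Y′ ⊆ Y × (a ∸ 1) * ∣ Y ∣ ≤ a * ∣ Y′ ∣ × ContainsNoPart Y′ p
  avoid-partition parts≥a Y =
    prune Y (allFin s) ,
    prune-⊆ Y (allFin s) ,
    Pruning⇒[a∸1]*∣Y∣≤a*∣Y′∣ (prune-Pruning parts≥a Y (allFin s)) ,
    λ x → part⊈prune Y (allFin s) (∈-allFin x)

ContainsNoPart-⊆ : ∀ {s} {Y Y′ : Subset s} {p} → Y′ ⊆ Y → ContainsNoPart Y p → ContainsNoPart Y′ p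
ContainsNoPart-⊆ Y′⊆Y Y-avoids x part⊆Y′ = Y-avoids x (⊆-trans part⊆Y′ Y′⊆Y)

avoid-partitions : ∀ s a σ (π : Fin σ → Fin s → ℕ) → (∀ i → AllPartsAtLeast a (π i)) →
  ∃ λ (Y : Subset s) → s * (a ∸ 1) ^ σ ≤ ∣ Y ∣ * a ^ σ × (∀ i → ContainsNoPart Y (π i))
avoid-partitions s a 0       π parts≥a = ⊤ , ≤-reflexive (cong (_* 1) (sym (∣⊤∣≡n s))) , λ ()
avoid-partitions s a (suc σ) π parts≥a
  with Y , bound , Y-avoids ← avoid-partitions s a σ (λ i → π (suc i)) (λ i → parts≥a (suc i))
  with Y′ , Y′⊆Y , step , Y′-avoids ← avoid-partition (π zero) (parts≥a zero) Y
  = Y′ , bound′ , avoids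
  where
  open ≤-Reasoning
  bound′ : s * (a ∸ 1) ^ suc σ ≤ ∣ Y′ ∣ * a ^ suc σ
  bound′ = begin
    s * ((a ∸ 1) * (a ∸ 1) ^ σ)   ≡⟨ x∙yz≈y∙xz s (a ∸ 1) _ ⟩
    (a ∸ 1) * (s * (a ∸ 1) ^ σ)   ≤⟨ *-monoʳ-≤ (a ∸ 1) bound ⟩
    (a ∸ 1) * (∣ Y ∣ * a ^ σ)     ≡⟨ *-assoc (a ∸ 1) ∣ Y ∣ _ ⟨
    (a ∸ 1) * ∣ Y ∣ * a ^ σ       ≤⟨ *-monoˡ-≤ (a ^ σ) step ⟩
    a * ∣ Y′ ∣ * a ^ σ            ≡⟨ xy∙z≈y∙xz a ∣ Y′ ∣ _ ⟩
    ∣ Y′ ∣ * (a * a ^ σ) ∎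
  avoids : ∀ i → ContainsNoPart Y′ (π i)
  avoids zero    = Y′-avoids
  avoids (suc i) = ContainsNoPart-⊆ {p = π (suc i)} Y′⊆Y (Y-avoids i)

lemma2p7 : (s a σ : ℕ) → .{{NonZero s}} → .{{NonZero a}} → .{{NonZero σ}} →
    (π : Fin σ → Fin s → ℕ) →
    (∀ i → AllPartsAtLeast a (π i)) →
    ∃ λ (Y : Subset s) →
      (s * (a ∸ 1) ^ σ ≤ ∣ Y ∣ * a ^ σ) × (∀ i → ContainsNoPart Y (π i))
lemma2p7 s a σ = avoid-partitions s a σ
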